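{- We have \begin{align*} g(K_2^+,s)&=1\quad\text{for all } s\ge2,\\ g(K_3^+,s)&=\log_s\left(\left\lfloor\frac{3(s-1)}{2}\right\rfloor+1\right)\quad\text{for all } s\ge2,\\ \lim_{s\to\infty}g(K_3^+,s)&=\inf_{s\ge2}g(K_3^+,s)=1,\\ \lim_{s\to\infty}g(K_4^+,s)&=2, \end{align*} and for all $n\ge4$, \[ n-3\le\limsup_{s\to\infty}g(K_n^+,s)\le n-2. \]
   Context: $K_n^+$ is the signed digraph on $[n]=\{0,\dots,n-1\}$ without loops having an arc $(j,i)$ for every ordered pair $j\ne i$, each signed $+1$. For $s\ge2$ and $[s]=\{0,\dots,s-1\}$, $F(K_n^+,s)$ is the set of maps $f:[s]^n\to[s]^n$ such that each $f_i$ does not depend on $x_i$ and is non-decreasing in every other coordinate. $g(K_n^+,s)=\max_{f\in F(K_n^+,s)}\log_s|\mathrm{Fix}(f)|$, with $\mathrm{Fix}(f)$ the set of fixed points of $f$. -}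

module Defs where

open import Data.Nat using (ℕ; zero; suc; _*_; _^_; _∸_; _+_)
import Data.Nat as ℕ
open import Data.Fin using (Fin; _≤_; _≟_)
open import Data.Vec using (Vec; []; _∷_; lookup)
open import Data.Vec.Properties using (≡-dec)
open import Data.List using (List; [_]; concatMap; map; allFin; filter; length)
open import Data.Product using (Σ; _×_)
open import Relation.Binary.PropositionalEquality using (_≡_; _≢_)

Config : ℕ → ℕ → Set
Config n s = Vec (Fin s) n

Map : ℕ → ℕ → Set
Map n s = Config n s → Config n s

IndepOfSelf : ∀ {n s} → Map n s → Set
IndepOfSelf {n} {s} f =
  ∀ (i : Fin n) (x y : Config n s) →
  (∀ j → j ≢ i → lookup x j ≡ lookup y j) →
  lookup (f x) i ≡ lookup (f y) i

-- f_i is non-decreasing in every coordinate j ≠ i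
-- (arcs (j,i) of K_n^+ for all j ≠ i, all signed +1).
MonoInOthers : ∀ {n s} → Map n s → Set
MonoInOthers {n} {s} f =
  ∀ (i j : Fin n) → j ≢ i → ∀ (x y : Config n s) →
  (∀ k → k ≢ j → lookup x k ≡ lookup y k) →
  lookup x j ≤ lookup y j →
  lookup (f x) i ≤ lookup (f y) i

InF : ∀ {n s} → Map n s → Set
InF f = IndepOfSelf f × MonoInOthers f

allConfigs : ∀ n s → List (Config n s)
allConfigs zero    s = [ [] ]
allConfigs (suc n) s = concatMap (λ a → map (a ∷_) (allConfigs n s)) (allFin s)

numFix : ∀ {n s} → Map n s → ℕ
numFix {n} {s} f = length (filter (λ x → ≡-dec _≟_ (f x) x) (allConfigs n s))

-- m = max_{f ∈ F(K_n^+,s)} |Fix(f)|, so that g(K_n^+,s) = log_s m.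
IsMaxFix : ℕ → ℕ → ℕ → Set
IsMaxFix n s m =
  Σ (Map n s) (λ f → InF f × numFix f ≡ m) ×
  (∀ (f : Map n s) → InF f → numFix f ℕ.≤ m)

{-# OPTIONS --safe #-}

-- The fixed points of a network in F(K_n^+, s) are pairwise compatible: if x ≤ y at every coordinate
-- except i, then xᵢ ≤ yᵢ, because fᵢ ignores coordinate i and is monotone in the others. Conversely a
-- pairwise compatible family consists of fixed points of the network whose i-th coordinate at z is the
-- largest i-th entry of a member lying below z away from i. So the maximum number of fixed points is the
-- largest size of a compatible family.
--
-- Compatible configurations that agree away from one coordinate are equal, which gives
-- s^(n-1). On three coordinates the difference of two distinct compatible configurations has no entry
-- of one sign and at least two entries of the other, so ⌊(x₀ + x₁ + x₂)/2⌋ together with the remaining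
-- coordinates determines a fixed point, which gives (⌊3(s-1)/2⌋ + 1) s^(n-3).
--
-- Configurations whose coordinates come in equal pairs are compatible, which gives
-- s^(n/2) for even n. A chain in [s]³ raising two coordinates at each step has ⌊3(s-1)/2⌋ + 1
-- compatible members. Configurations with equal moments Σⱼ xⱼ, Σⱼ j xⱼ, Σⱼ j² xⱼ are compatible, since
-- Σⱼ ((j-i)² - 1)(yⱼ - xⱼ) = 0 and every term with j ≠ i is non-negative when x ≤ y away from i; the
-- moments take O(s³) values, so some moment class has at least s^n / O(s³) members.
module Submission where

open import Defs
open import Data.Empty using (⊥; ⊥-elim)
open import Data.Fin using (Fin; zero; suc; toℕ; fromℕ<; _≟_)
import Data.Fin.Properties as FP
open import Data.List using (List; []; _∷_; _++_; length; map; filter; concatMap; cartesianProductWith; cartesianProduct; allFin; upTo)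
import Data.List.Extrema
open import Data.List.Membership.Propositional using (_∈_)
open import Data.List.Membership.Propositional.Properties
  using (∈-filter⁺; ∈-filter⁻; ∈-map⁺; ∈-map⁻; ∈-allFin; ∈-upTo⁺; ∈-cartesianProductWith⁺; ∈-cartesianProduct⁺)
open import Data.List.Properties using (length-++; length-map; length-tabulate; length-upTo; length-removeAt′)
open import Data.List.Relation.Binary.Sublist.Propositional.Properties using (filter⁺; filter-⊆; length-mono-≤)
import Data.List.Relation.Binary.Subset.Propositional.Properties as ⊆
open import Data.List.Relation.Unary.All as All using ([])
import Data.List.Relation.Unary.All.Properties as All
open import Data.List.Relation.Unary.AllPairs using ([]; _∷_)
open import Data.List.Relation.Unary.Any using (here; there; _─_; index)
open import Data.List.Relation.Unary.Unique.Propositional using (Unique)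
import Data.List.Relation.Unary.Unique.Propositional.Properties as Unique
import Data.Nat as ℕ
open import Data.Nat using (ℕ; zero; suc; _+_; _*_; _^_; _∸_; _/_; _≤_; _<_; z≤n; s≤s; s≤s⁻¹; _≤′_; ≤′-refl; ≤′-step; NonZero; >-nonZero)
open import Data.Nat.DivMod using (_%_; m≡m%n+[m/n]*n; m%n<n; m/n*n≤m; m*n/n≡m; /-monoˡ-≤)
open import Data.Nat.Properties hiding (_≟_)
open import Data.Nat.Tactic.RingSolver using (solve-∀)
open import Algebra.Properties.Semiring.Sum +-*-semiring using (sum; ∑-distrib-+; *-distribˡ-sum)
open import Data.Product using (Σ; ∃; _×_; _,_; proj₁; proj₂)
import Data.Product.Properties as ×
open import Data.Sum using (_⊎_; inj₁; inj₂)
open import Data.Vec using (Vec; []; _∷_; lookup; tabulate; tail; _[_]≔_)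
open import Data.Vec.Properties
  using (∷-injective; ∷-injectiveˡ; ∷-injectiveʳ; ≡-dec; tabulate∘lookup; tabulate-cong; lookup∘tabulate; lookup∘update; lookup∘update′)
open import Function using (_∘_; id)
open import Relation.Binary.Definitions using (DecidableEquality; tri<; tri≈; tri>)
open import Relation.Binary.PropositionalEquality
  using (_≡_; _≢_; refl; sym; trans; cong; cong₂; subst; subst₂; module ≡-Reasoning)
open import Relation.Nullary using (Dec; yes; no; ¬?; contradiction)
open import Relation.Nullary.Decidable using (_→-dec_)
open import Relation.Unary using (Decidable)

private
  variable
    A B : Set

∈-─⁺ : ∀ {x y : A} {xs} (x∈xs : x ∈ xs) → y ∈ xs → y ≢ x → y ∈ (xs ─ x∈xs)
∈-─⁺ (here refl)  (here refl)  y≢x = ⊥-elim (y≢x refl)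
∈-─⁺ (here refl)  (there y∈xs) _   = y∈xs
∈-─⁺ (there x∈xs) (here refl)  _   = here refl
∈-─⁺ (there x∈xs) (there y∈xs) y≢x = there (∈-─⁺ x∈xs y∈xs y≢x)

injection⇒length≤ : ∀ (g : A → B) {xs ys} → Unique xs → (∀ {x} → x ∈ xs → g x ∈ ys) →
                    (∀ {x y} → x ∈ xs → y ∈ xs → g x ≡ g y → x ≡ y) → length xs ≤ length ys
injection⇒length≤ g {[]} _ _ _ = z≤n
injection⇒length≤ g {x ∷ xs} {ys} (x∉xs ∷ xs!) g∈ys inj = begin
  suc (length xs)           ≤⟨ s≤s (injection⇒length≤ g xs! g∈ys─gx (λ p q → inj (there p) (there q))) ⟩
  suc (length (ys ─ gx∈ys)) ≡⟨ sym (length-removeAt′ ys (index gx∈ys)) ⟩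
  length ys                 ∎
  where
  open ≤-Reasoning
  gx∈ys = g∈ys (here refl)
  g∈ys─gx : ∀ {y} → y ∈ xs → g y ∈ (ys ─ gx∈ys)
  g∈ys─gx y∈xs = ∈-─⁺ gx∈ys (g∈ys (there y∈xs))
    (λ gy≡gx → All.lookup x∉xs y∈xs (sym (inj (there y∈xs) (here refl) gy≡gx)))

length-cartesianProductWith : ∀ {C : Set} (f : A → B → C) xs ys →
                              length (cartesianProductWith f xs ys) ≡ length xs * length ys
length-cartesianProductWith f []       ys = refl
length-cartesianProductWith f (x ∷ xs) ys = begin
  length (map (f x) ys ++ cartesianProductWith f xs ys) ≡⟨ length-++ (map (f x) ys) ⟩
  length (map (f x) ys) + length (cartesianProductWith f xs ys)
    ≡⟨ cong₂ _+_ (length-map (f x) ys) (length-cartesianProductWith f xs ys) ⟩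
  length ys + length xs * length ys ∎
  where open ≡-Reasoning

length-filter-split : ∀ {P : A → Set} (P? : Decidable P) xs →
                      length xs ≡ length (filter P? xs) + length (filter (¬? ∘ P?) xs)
length-filter-split P? []       = refl
length-filter-split P? (x ∷ xs) with P? x
... | yes _ = cong suc (length-filter-split P? xs)
... | no  _ = trans (cong suc (length-filter-split P? xs)) (sym (+-suc _ _))

module _ (code : A → B) (_≟_ : DecidableEquality B) where

  fiber : B → List A → List A
  fiber b = filter (λ x → code x ≟ b)

  -- The default element b₀ is only returned when xs and ys are both empty.
  pigeonhole : B → ∀ ys xs → (∀ {x} → x ∈ xs → code x ∈ ys) →
               ∃ λ b → length xs ≤ length ys * length (fiber b xs)
  pigeonhole b₀ []       []       _     = b₀ , z≤n
  pigeonhole b₀ []       (x ∷ xs) code∈ with () ← code∈ (here refl)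
  pigeonhole b₀ (y ∷ ys) xs code∈ =
    let b , rest≤ = pigeonhole b₀ ys rest code∈ys in pick b (bound b rest≤)
    where
    rest = filter (λ x → ¬? (code x ≟ y)) xs
    code∈ys : ∀ {x} → x ∈ rest → code x ∈ ys
    code∈ys x∈rest with ∈-filter⁻ (λ x → ¬? (code x ≟ y)) x∈rest
    ... | x∈xs , codex≢y with code∈ x∈xs
    ...   | here codex≡y   = ⊥-elim (codex≢y codex≡y)
    ...   | there codex∈ys = codex∈ys
    bound : ∀ b → length rest ≤ length ys * length (fiber b rest) →
            length xs ≤ length (fiber y xs) + length ys * length (fiber b xs)
    bound b rest≤ = begin
      length xs                                           ≡⟨ length-filter-split (λ x → code x ≟ y) xs ⟩
      length (fiber y xs) + length rest                   ≤⟨ +-monoʳ-≤ _ rest≤ ⟩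
      length (fiber y xs) + length ys * length (fiber b rest)
        ≤⟨ +-monoʳ-≤ _ (*-monoʳ-≤ (length ys) (length-mono-≤ (filter⁺ _ _ (λ { refl p → p }) (filter-⊆ _ xs)))) ⟩
      length (fiber y xs) + length ys * length (fiber b xs) ∎
      where open ≤-Reasoning
    pick : ∀ b → length xs ≤ length (fiber y xs) + length ys * length (fiber b xs) →
           ∃ λ b → length xs ≤ length (y ∷ ys) * length (fiber b xs)
    pick b xs≤ with length (fiber y xs) ≤? length (fiber b xs)
    ... | yes y≤b = b , ≤-trans xs≤ (+-monoˡ-≤ _ y≤b)
    ... | no  y≰b = y , ≤-trans xs≤ (+-monoʳ-≤ _ (*-monoʳ-≤ (length ys) (<⇒≤ (≰⇒> y≰b))))

concatMap-map≡cartesianProductWith : ∀ {C : Set} (f : A → B → C) xs ys →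
                                     concatMap (λ x → map (f x) ys) xs ≡ cartesianProductWith f xs ys
concatMap-map≡cartesianProductWith f []       ys = refl
concatMap-map≡cartesianProductWith f (x ∷ xs) ys =
  cong (map (f x) ys ++_) (concatMap-map≡cartesianProductWith f xs ys)

module _ {s : ℕ} where

  allConfigs-suc : ∀ n → allConfigs (suc n) s ≡ cartesianProductWith _∷_ (allFin s) (allConfigs n s)
  allConfigs-suc n = concatMap-map≡cartesianProductWith _∷_ (allFin s) (allConfigs n s)

  ∈-allConfigs : ∀ {n} (x : Config n s) → x ∈ allConfigs n s
  ∈-allConfigs []      = here refl
  ∈-allConfigs {suc n} (a ∷ x) = subst (a ∷ x ∈_) (sym (allConfigs-suc n))
    (∈-cartesianProductWith⁺ _∷_ (∈-allFin a) (∈-allConfigs x))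

  allConfigs-unique : ∀ n → Unique (allConfigs n s)
  allConfigs-unique zero    = [] ∷ []
  allConfigs-unique (suc n) = subst Unique (sym (allConfigs-suc n))
    (Unique.cartesianProductWith⁺ _∷_ ∷-injective (Unique.allFin⁺ s) (allConfigs-unique n))

  length-allConfigs : ∀ n → length (allConfigs n s) ≡ s ^ n
  length-allConfigs zero    = refl
  length-allConfigs (suc n) = begin
    length (allConfigs (suc n) s)                                    ≡⟨ cong length (allConfigs-suc n) ⟩
    length (cartesianProductWith _∷_ (allFin s) (allConfigs n s))    ≡⟨ length-cartesianProductWith _∷_ (allFin s) (allConfigs n s) ⟩
    length (allFin s) * length (allConfigs n s)                      ≡⟨ cong₂ _*_ (length-tabulate {n = s} id) (length-allConfigs n) ⟩
    s * s ^ n                                                        ∎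
    where open ≡-Reasoning

module _ {n s : ℕ} where

  fixedPoints : Map n s → List (Config n s)
  fixedPoints f = filter (λ x → ≡-dec _≟_ (f x) x) (allConfigs n s)

  ∈-fixedPoints⁺ : ∀ {f : Map n s} {x} → f x ≡ x → x ∈ fixedPoints f
  ∈-fixedPoints⁺ {f} {x} = ∈-filter⁺ (λ x → ≡-dec _≟_ (f x) x) (∈-allConfigs x)

  ∈-fixedPoints⁻ : ∀ {f : Map n s} {x} → x ∈ fixedPoints f → f x ≡ x
  ∈-fixedPoints⁻ {f} x∈ = proj₂ (∈-filter⁻ (λ x → ≡-dec _≟_ (f x) x) {xs = allConfigs n s} x∈)

  fixedPoints-unique : ∀ (f : Map n s) → Unique (fixedPoints f)
  fixedPoints-unique f = Unique.filter⁺ _ (allConfigs-unique n)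

lookup-ext : ∀ {n} {xs ys : Vec A n} → (∀ j → lookup xs j ≡ lookup ys j) → xs ≡ ys
lookup-ext {xs = xs} {ys} eq = trans (sym (tabulate∘lookup xs)) (trans (tabulate-cong eq) (tabulate∘lookup ys))

-- Compatible configurations

module _ {n s : ℕ} where

  ⟦_⟧ : Config n s → Fin n → ℕ
  ⟦ x ⟧ j = toℕ (lookup x j)

  _≤_off_ : Config n s → Config n s → Fin n → Set
  x ≤ y off i = ∀ j → j ≢ i → ⟦ x ⟧ j ≤ ⟦ y ⟧ j

  Compatible : Config n s → Config n s → Set
  Compatible x y = ∀ i → x ≤ y off i → ⟦ x ⟧ i ≤ ⟦ y ⟧ i

module _ {n s : ℕ} {x y : Config n s} where

  ≤⇒compatible : (∀ j → ⟦ x ⟧ j ≤ ⟦ y ⟧ j) → Compatible x y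
  ≤⇒compatible x≤y i _ = x≤y i

  dropsTwice⇒compatible : (∀ i → ∃ λ j → j ≢ i × ⟦ y ⟧ j < ⟦ x ⟧ j) → Compatible x y
  dropsTwice⇒compatible drops i x≤y = let j , j≢i , y<x = drops i in ⊥-elim (<⇒≱ y<x (x≤y j j≢i))

twins⇒compatible : ∀ {n s} (τ : Fin n → Fin n) → (∀ i → τ i ≢ i) → ∀ {x y : Config n s} →
                   (∀ i → lookup x (τ i) ≡ lookup x i) → (∀ i → lookup y (τ i) ≡ lookup y i) → Compatible x y
twins⇒compatible τ τi≢i x∘τ≡x y∘τ≡y i x≤y =
  subst₂ (λ u v → toℕ u ≤ toℕ v) (x∘τ≡x i) (y∘τ≡y i) (x≤y (τ i) (τi≢i i))

module _ {n s : ℕ} where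

  -- Walking from z to y one coordinate at a time reduces monotonicity off i to the hypotheses of InF.
  copyAt : List (Fin n) → Config n s → Config n s → Config n s
  copyAt []       y z = z
  copyAt (j ∷ js) y z = copyAt js y (z [ j ]≔ lookup y j)

  lookup-copyAt : ∀ js y z j → lookup z j ≡ lookup y j ⊎ j ∈ js → lookup (copyAt js y z) j ≡ lookup y j
  lookup-copyAt []       y z j (inj₁ zj≡yj) = zj≡yj
  lookup-copyAt (k ∷ js) y z j zj≡yj⊎j∈ = lookup-copyAt js y (z [ k ]≔ lookup y k) j (step zj≡yj⊎j∈)
    where
    step : lookup z j ≡ lookup y j ⊎ j ∈ k ∷ js → lookup (z [ k ]≔ lookup y k) j ≡ lookup y j ⊎ j ∈ js
    step (inj₂ (there j∈js)) = inj₂ j∈js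
    step (inj₂ (here refl))  = inj₁ (lookup∘update j z (lookup y j))
    step (inj₁ zj≡yj) with j ≟ k
    ... | yes refl = inj₁ (lookup∘update j z (lookup y j))
    ... | no  j≢k  = inj₁ (trans (lookup∘update′ j≢k z (lookup y k)) zj≡yj)

  copyAt-allFin : ∀ y z → copyAt (allFin n) y z ≡ y
  copyAt-allFin y z = lookup-ext (λ j → lookup-copyAt (allFin n) y z j (inj₂ (∈-allFin j)))

  module _ {f : Map n s} (f∈F : InF f) where

    update-monotone : ∀ i j z v → (j ≢ i → toℕ (lookup z j) ≤ toℕ v) → ⟦ f z ⟧ i ≤ ⟦ f (z [ j ]≔ v) ⟧ i
    update-monotone i j z v zj≤v with j ≟ i
    ... | yes refl = ≤-reflexive (cong toℕ (proj₁ f∈F i z (z [ i ]≔ v) (λ k k≢i → sym (lookup∘update′ k≢i z v))))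
    ... | no  j≢i  = proj₂ f∈F i j j≢i z (z [ j ]≔ v) (λ k k≢j → sym (lookup∘update′ k≢j z v))
                       (subst (toℕ (lookup z j) ≤_) (cong toℕ (sym (lookup∘update j z v))) (zj≤v j≢i))

    copyAt-monotone : ∀ {i} js {y} z → z ≤ y off i → ⟦ f z ⟧ i ≤ ⟦ f (copyAt js y z) ⟧ i
    copyAt-monotone []       z _ = ≤-refl
    copyAt-monotone {i} (j ∷ js) {y} z z≤y =
      ≤-trans (update-monotone i j z (lookup y j) (z≤y j)) (copyAt-monotone js (z [ j ]≔ lookup y j) z′≤y)
      where
      z′≤y : (z [ j ]≔ lookup y j) ≤ y off i
      z′≤y k k≢i with k ≟ j
      ... | yes refl = ≤-reflexive (cong toℕ (lookup∘update k z (lookup y k)))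
      ... | no  k≢j  = subst (_≤ ⟦ y ⟧ k) (cong toℕ (sym (lookup∘update′ k≢j z (lookup y j)))) (z≤y k k≢i)

    InF⇒monotone : ∀ {x y i} → x ≤ y off i → ⟦ f x ⟧ i ≤ ⟦ f y ⟧ i
    InF⇒monotone {x} {y} x≤y = subst (λ w → ⟦ f x ⟧ _ ≤ ⟦ f w ⟧ _) (copyAt-allFin y x) (copyAt-monotone (allFin n) x x≤y)

    fixedPoints-compatible : ∀ {x y} → f x ≡ x → f y ≡ y → Compatible x y
    fixedPoints-compatible fx≡x fy≡y i x≤y = subst₂ (λ u v → ⟦ u ⟧ i ≤ ⟦ v ⟧ i) fx≡x fy≡y (InF⇒monotone x≤y)

LowerBound : ℕ → ℕ → ℕ → Set
LowerBound n s a = Σ (Map n s) λ f → InF f × a ≤ numFix f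

UpperBound : ℕ → ℕ → ℕ → Set
UpperBound n s b = ∀ (f : Map n s) → InF f → numFix f ≤ b

module _ {n s : ℕ} where

  isMaxFix : ∀ {m} → LowerBound n s m → UpperBound n s m → IsMaxFix n s m
  isMaxFix (f , f∈F , m≤) upper = (f , f∈F , ≤-antisym (upper f f∈F) m≤) , upper

  IsMaxFix⇒≤ : ∀ {m b} → IsMaxFix n s m → UpperBound n s b → m ≤ b
  IsMaxFix⇒≤ ((f , f∈F , refl) , _) upper = upper f f∈F

  IsMaxFix⇒≥ : ∀ {m a} → IsMaxFix n s m → LowerBound n s a → a ≤ m
  IsMaxFix⇒≥ (_ , upper) (f , f∈F , a≤) = ≤-trans a≤ (upper f f∈F)

  IsMaxFix-unique : ∀ {m m′} → IsMaxFix n s m → IsMaxFix n s m′ → m ≡ m′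
  IsMaxFix-unique max max′ = ≤-antisym (IsMaxFix⇒≤ max (proj₂ max′)) (IsMaxFix⇒≤ max′ (proj₂ max))

  upperBound-by-code : ∀ (code : Config n s → A) codes → (∀ x → code x ∈ codes) →
                       (∀ {x y} → Compatible x y → Compatible y x → code x ≡ code y → x ≡ y) →
                       UpperBound n s (length codes)
  upperBound-by-code code codes code∈ injective f f∈F =
    injection⇒length≤ code (fixedPoints-unique f) (λ _ → code∈ _) λ x∈ y∈ →
      injective (compatible x∈ y∈) (compatible y∈ x∈)
    where
    compatible : ∀ {x y} → x ∈ fixedPoints f → y ∈ fixedPoints f → Compatible x y
    compatible x∈ y∈ = fixedPoints-compatible f∈F (∈-fixedPoints⁻ x∈) (∈-fixedPoints⁻ y∈)

module Realise {n s : ℕ} (L : List (Config n (suc s))) (compatible : ∀ {x y} → x ∈ L → y ∈ L → Compatible x y) where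

  open Data.List.Extrema (FP.≤-totalOrder (suc s)) using (max; max≤v⁺; xs≤max; max-mono-⊆)

  below? : ∀ (z : Config n (suc s)) i y → Dec (y ≤ z off i)
  below? z i y = FP.all? λ j → ¬? (j ≟ i) →-dec (⟦ y ⟧ j ≤? ⟦ z ⟧ j)

  candidates : Config n (suc s) → Fin n → List (Fin (suc s))
  candidates z i = map (λ y → lookup y i) (filter (below? z i) L)

  best : Config n (suc s) → Fin n → Fin (suc s)
  best z i = max zero (candidates z i)

  realise : Map n (suc s)
  realise z = tabulate (best z)

  best-monotone : ∀ {z z′ : Config n (suc s)} {i} → z ≤ z′ off i → toℕ (best z i) ≤ toℕ (best z′ i)
  best-monotone {z} {z′} {i} z≤z′ = max-mono-⊆ {xs = candidates z i} {ys = candidates z′ i} ≤-refl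
    (⊆.map⁺ _ (⊆.filter⁺′ (below? z i) (below? z′ i) (λ y≤z j j≢i → ≤-trans (y≤z j j≢i) (z≤z′ j j≢i)) {L} id))

  realise-monotone : ∀ {z z′ : Config n (suc s)} {i} → z ≤ z′ off i → ⟦ realise z ⟧ i ≤ ⟦ realise z′ ⟧ i
  realise-monotone {z} {z′} {i} z≤z′ = subst₂ (λ u v → toℕ u ≤ toℕ v)
    (sym (lookup∘tabulate (best z) i)) (sym (lookup∘tabulate (best z′) i)) (best-monotone {z} {z′} z≤z′)

  realise-InF : InF realise
  realise-InF = indep , mono
    where
    indep : IndepOfSelf realise
    indep i x y x≡y = FP.≤-antisym (realise-monotone {x} {y} λ j j≢i → ≤-reflexive (cong toℕ (x≡y j j≢i)))
                                   (realise-monotone {y} {x} λ j j≢i → ≤-reflexive (cong toℕ (sym (x≡y j j≢i))))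
    mono : MonoInOthers realise
    mono i j _ x y x≡y xj≤yj = realise-monotone {x} {y} x≤y
      where
      x≤y : x ≤ y off i
      x≤y k _ with k ≟ j
      ... | yes refl = xj≤yj
      ... | no  k≢j  = ≤-reflexive (cong toℕ (x≡y k k≢j))

  realise-fixes : ∀ {x} → x ∈ L → realise x ≡ x
  realise-fixes {x} x∈L = lookup-ext λ i → trans (lookup∘tabulate (best x) i) (FP.≤-antisym
    (max≤v⁺ z≤n (All.map⁺ (All.tabulate (λ y∈ → below⇒≤ i (∈-filter⁻ (below? x i) {xs = L} y∈)))))
    (All.lookup (xs≤max zero (candidates x i)) (∈-map⁺ (λ y → lookup y i) (∈-filter⁺ (below? x i) x∈L (λ _ _ → ≤-refl)))))
    where
    below⇒≤ : ∀ i {y} → y ∈ L × y ≤ x off i → ⟦ y ⟧ i ≤ ⟦ x ⟧ i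
    below⇒≤ i (y∈L , y≤x) = compatible y∈L x∈L i y≤x

  lowerBound : Unique L → LowerBound n (suc s) (length L)
  lowerBound L! = realise , realise-InF ,
    injection⇒length≤ id L! (∈-fixedPoints⁺ ∘ realise-fixes) (λ _ _ → id)

-- Upper bounds

upperBound-tail : ∀ n s → UpperBound (suc n) s (s ^ n)
upperBound-tail n s = subst (UpperBound (suc n) s) (length-allConfigs n)
  (upperBound-by-code tail (allConfigs n s) (∈-allConfigs ∘ tail) injective)
  where
  ≤-off-head : ∀ {a b t} → (a ∷ t) ≤ (b ∷ t) off zero
  ≤-off-head zero    0≢0 = ⊥-elim (0≢0 refl)
  ≤-off-head (suc _) _   = ≤-refl
  injective : ∀ {x y : Config (suc n) s} → Compatible x y → Compatible y x → tail x ≡ tail y → x ≡ y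
  injective {a ∷ t} {b ∷ .t} x~y y~x refl =
    cong (_∷ t) (FP.≤-antisym (x~y zero ≤-off-head) (y~x zero ≤-off-head))

Triple : Set
Triple = ℕ × ℕ × ℕ

-- Written cyclically, so that rotate acts on it by rotating its three components.
Compatible₃ : Triple → Triple → Set
Compatible₃ (a , b , c) (a′ , b′ , c′) =
  (b ≤ b′ → c ≤ c′ → a ≤ a′) × (c ≤ c′ → a ≤ a′ → b ≤ b′) × (a ≤ a′ → b ≤ b′ → c ≤ c′)

_≤₃_ : Triple → Triple → Set
(a , b , c) ≤₃ (a′ , b′ , c′) = a ≤ a′ × b ≤ b′ × c ≤ c′

sum₃ : Triple → ℕ
sum₃ (a , b , c) = a + b + c

rotate : Triple → Triple
rotate (a , b , c) = b , c , a

module _ {u v : Triple} where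

  rotate-compatible₃ : Compatible₃ u v → Compatible₃ (rotate u) (rotate v)
  rotate-compatible₃ (ca , cb , cc) = cb , cc , ca

  rotate-≤₃ : u ≤₃ v → rotate u ≤₃ rotate v
  rotate-≤₃ (a≤ , b≤ , c≤) = b≤ , c≤ , a≤

sum₃-rotate : ∀ u → sum₃ (rotate u) ≡ sum₃ u
sum₃-rotate (a , b , c) = rotation a b c
  where
  rotation : ∀ a b c → b + c + a ≡ a + b + c
  rotation = solve-∀

head-≤⇒≤₃ : (P : Triple → Triple → Set) → (∀ {u v} → P u v → P (rotate u) (rotate v)) →
            (∀ {u v} → P u v → proj₁ u ≤ proj₁ v) → ∀ {u v} → P u v → u ≤₃ v
head-≤⇒≤₃ P rotate-P head-≤ p = head-≤ p , head-≤ (rotate-P p) , head-≤ (rotate-P (rotate-P p))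

SumBelow : Triple → Triple → Set
SumBelow u v = Compatible₃ u v × Compatible₃ v u × sum₃ u ≤ sum₃ v

-- If a′ < a, compatibility of u with v forbids b ≤ b′ and c ≤ c′ together, and if, say, b′ < b
-- then compatibility of v with u also gives c′ ≤ c, pushing the sum of v below that of u.
sumBelow-head-≤ : ∀ {u v} → SumBelow u v → proj₁ u ≤ proj₁ v
sumBelow-head-≤ {a , b , c} {a′ , b′ , c′} ((ca , _ , _) , (_ , cb′ , cc′) , Σ≤) with a ≤? a′
... | yes a≤a′ = a≤a′
... | no  a≰a′ = ⊥-elim (no-drop (≰⇒> a≰a′))
  where
  drop-contradicts : a′ < a → b′ ≤ b → c′ ≤ c → ⊥
  drop-contradicts a′<a b′≤b c′≤c = <⇒≱ (+-mono-<-≤ (+-mono-<-≤ a′<a b′≤b) c′≤c) Σ≤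
  no-drop : a′ < a → ⊥
  no-drop a′<a with b ≤? b′ | c ≤? c′
  ... | yes b≤b′ | yes c≤c′ = <⇒≱ a′<a (ca b≤b′ c≤c′)
  ... | no  b≰b′ | _        = let b′≤b = <⇒≤ (≰⇒> b≰b′) in drop-contradicts a′<a b′≤b (cc′ (<⇒≤ a′<a) b′≤b)
  ... | yes _    | no  c≰c′ = let c′≤c = <⇒≤ (≰⇒> c≰c′) in drop-contradicts a′<a (cb′ c′≤c (<⇒≤ a′<a)) c′≤c

sumBelow⇒≤₃ : ∀ {u v} → SumBelow u v → u ≤₃ v
sumBelow⇒≤₃ = head-≤⇒≤₃ SumBelow rotate-sumBelow sumBelow-head-≤
  where
  rotate-sumBelow : ∀ {u v} → SumBelow u v → SumBelow (rotate u) (rotate v)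
  rotate-sumBelow {u} {v} (u~v , v~u , Σ≤) = rotate-compatible₃ u~v , rotate-compatible₃ v~u ,
    subst₂ _≤_ (sym (sum₃-rotate u)) (sym (sum₃-rotate v)) Σ≤

JustAbove : Triple → Triple → Set
JustAbove v u = u ≤₃ v × Compatible₃ v u × sum₃ v ≤ suc (sum₃ u)

-- If a < a′, the bound on the sums leaves b′ ≤ b and c′ ≤ c, and then compatibility of v with u gives a′ ≤ a.
justAbove-head-≤ : ∀ {v u} → JustAbove v u → proj₁ v ≤ proj₁ u
justAbove-head-≤ {a′ , b′ , c′} {a , b , c} ((a≤a′ , b≤b′ , c≤c′) , (ca′ , _ , _) , Σ≤) with a′ ≤? a
... | yes a′≤a = a′≤a
... | no  a′≰a = ca′ (+-cancelʳ-≤ c b′ b (≤-trans (+-monoʳ-≤ b′ c≤c′) rest≤))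
                     (+-cancelˡ-≤ b c′ c (≤-trans (+-monoˡ-≤ c′ b≤b′) rest≤))
  where
  rest≤ : b′ + c′ ≤ b + c
  rest≤ = +-cancelˡ-≤ (suc a) _ _ (begin
    suc a + (b′ + c′) ≤⟨ +-monoˡ-≤ _ (≰⇒> a′≰a) ⟩
    a′ + (b′ + c′)    ≡⟨ sym (+-assoc a′ b′ c′) ⟩
    a′ + b′ + c′      ≤⟨ Σ≤ ⟩
    suc (a + b + c)   ≡⟨ cong suc (+-assoc a b c) ⟩
    suc a + (b + c)   ∎)
    where open ≤-Reasoning

justAbove⇒≤₃ : ∀ {v u} → JustAbove v u → v ≤₃ u
justAbove⇒≤₃ = head-≤⇒≤₃ JustAbove rotate-justAbove justAbove-head-≤
  where
  rotate-justAbove : ∀ {v u} → JustAbove v u → JustAbove (rotate v) (rotate u)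
  rotate-justAbove {v} {u} (u≤v , v~u , Σ≤) = rotate-≤₃ u≤v , rotate-compatible₃ v~u ,
    subst₂ (λ m n → m ≤ suc n) (sym (sum₃-rotate v)) (sym (sum₃-rotate u)) Σ≤

≤₃-antisym : ∀ {u v} → u ≤₃ v → v ≤₃ u → u ≡ v
≤₃-antisym (a≤ , b≤ , c≤) (a≥ , b≥ , c≥) = cong₂ _,_ (≤-antisym a≤ a≥) (cong₂ _,_ (≤-antisym b≤ b≥) (≤-antisym c≤ c≥))

close-sums⇒≡ : ∀ {u v} → Compatible₃ u v → Compatible₃ v u → sum₃ u ≤ sum₃ v → sum₃ v ≤ suc (sum₃ u) → u ≡ v
close-sums⇒≡ u~v v~u Σ≤ Σ≤suc = ≤₃-antisym u≤v (justAbove⇒≤₃ (u≤v , v~u , Σ≤suc))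
  where u≤v = sumBelow⇒≤₃ (u~v , v~u , Σ≤)

/2≡⇒≤suc : ∀ m n → m / 2 ≡ n / 2 → n ≤ suc m
/2≡⇒≤suc m n m/2≡n/2 = begin
  n                 ≡⟨ m≡m%n+[m/n]*n n 2 ⟩
  n % 2 + n / 2 * 2 ≤⟨ +-mono-≤ (s≤s⁻¹ (m%n<n n 2)) (≤-reflexive (cong (_* 2) (sym m/2≡n/2))) ⟩
  1 + m / 2 * 2     ≤⟨ s≤s (m/n*n≤m m 2) ⟩
  suc m             ∎
  where open ≤-Reasoning

compatible₃-halfSum-injective : ∀ {u v} → Compatible₃ u v → Compatible₃ v u → sum₃ u / 2 ≡ sum₃ v / 2 → u ≡ v
compatible₃-halfSum-injective {u} {v} u~v v~u halves≡ with ≤-total (sum₃ u) (sum₃ v)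
... | inj₁ Σ≤ = close-sums⇒≡ u~v v~u Σ≤ (/2≡⇒≤suc _ _ halves≡)
... | inj₂ Σ≥ = sym (close-sums⇒≡ v~u u~v Σ≥ (/2≡⇒≤suc _ _ (sym halves≡)))

maxFix₃ : ℕ → ℕ
maxFix₃ s = 3 * (s ∸ 1) / 2 + 1

module _ {r s : ℕ} where

  ≤-off₃ : ∀ {a b c a′ b′ c′ : Fin s} {t : Config r s} i →
           (zero ≢ i → toℕ a ≤ toℕ a′) → (suc zero ≢ i → toℕ b ≤ toℕ b′) → (suc (suc zero) ≢ i → toℕ c ≤ toℕ c′) →
           (a ∷ b ∷ c ∷ t) ≤ (a′ ∷ b′ ∷ c′ ∷ t) off i
  ≤-off₃ i a≤ b≤ c≤ zero                  = a≤
  ≤-off₃ i a≤ b≤ c≤ (suc zero)            = b≤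
  ≤-off₃ i a≤ b≤ c≤ (suc (suc zero))      = c≤
  ≤-off₃ i a≤ b≤ c≤ (suc (suc (suc _))) _ = ≤-refl

  compatible⇒compatible₃ : ∀ {a b c a′ b′ c′ : Fin s} {t : Config r s} →
                           Compatible (a ∷ b ∷ c ∷ t) (a′ ∷ b′ ∷ c′ ∷ t) →
                           Compatible₃ (toℕ a , toℕ b , toℕ c) (toℕ a′ , toℕ b′ , toℕ c′)
  compatible⇒compatible₃ x~y =
    (λ b≤ c≤ → x~y zero             (≤-off₃ _ (contradiction refl) (λ _ → b≤) (λ _ → c≤))) ,
    (λ c≤ a≤ → x~y (suc zero)       (≤-off₃ _ (λ _ → a≤) (contradiction refl) (λ _ → c≤))) ,
    (λ a≤ b≤ → x~y (suc (suc zero)) (≤-off₃ _ (λ _ → a≤) (λ _ → b≤) (contradiction refl)))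

  halfSum : Config (3 + r) s → ℕ × Config r s
  halfSum (a ∷ b ∷ c ∷ t) = sum₃ (toℕ a , toℕ b , toℕ c) / 2 , t

  halfSum-injective : ∀ {x y} → Compatible x y → Compatible y x → halfSum x ≡ halfSum y → x ≡ y
  halfSum-injective {a ∷ b ∷ c ∷ t} {a′ ∷ b′ ∷ c′ ∷ t′} x~y y~x codes≡ with ×.,-injective codes≡
  ... | halves≡ , refl with compatible₃-halfSum-injective (compatible⇒compatible₃ x~y) (compatible⇒compatible₃ y~x) halves≡
  ... | triples≡ = cong₂ _∷_ (FP.toℕ-injective (cong proj₁ triples≡))
                  (cong₂ _∷_ (FP.toℕ-injective (cong (proj₁ ∘ proj₂) triples≡))
                  (cong (_∷ t) (FP.toℕ-injective (cong (proj₂ ∘ proj₂) triples≡))))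

toℕ≤s∸1 : ∀ {s} (a : Fin s) → toℕ a ≤ s ∸ 1
toℕ≤s∸1 {suc _} a = FP.toℕ≤pred[n] a

halfSum<maxFix₃ : ∀ {s} (a b c : Fin s) → sum₃ (toℕ a , toℕ b , toℕ c) / 2 < maxFix₃ s
halfSum<maxFix₃ {s} a b c =
  subst (sum₃ (toℕ a , toℕ b , toℕ c) / 2 <_) (+-comm 1 (3 * (s ∸ 1) / 2)) (s≤s (/-monoˡ-≤ 2 (begin
  toℕ a + toℕ b + toℕ c       ≤⟨ +-mono-≤ (+-mono-≤ (toℕ≤s∸1 a) (toℕ≤s∸1 b)) (toℕ≤s∸1 c) ⟩
  s ∸ 1 + (s ∸ 1) + (s ∸ 1)   ≡⟨ thrice (s ∸ 1) ⟩
  3 * (s ∸ 1)                 ∎)))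
  where
  open ≤-Reasoning
  thrice : ∀ k → k + k + k ≡ 3 * k
  thrice = solve-∀

upperBound-halfSum : ∀ r s → UpperBound (3 + r) s (maxFix₃ s * s ^ r)
upperBound-halfSum r s = subst (UpperBound (3 + r) s) length-codes
  (upperBound-by-code halfSum codes halfSum∈codes halfSum-injective)
  where
  codes = cartesianProduct (upTo (maxFix₃ s)) (allConfigs r s)
  halfSum∈codes : ∀ x → halfSum x ∈ codes
  halfSum∈codes (a ∷ b ∷ c ∷ t) = ∈-cartesianProduct⁺ (∈-upTo⁺ (halfSum<maxFix₃ a b c)) (∈-allConfigs t)
  length-codes : length codes ≡ maxFix₃ s * s ^ r
  length-codes = trans (length-cartesianProductWith _,_ (upTo (maxFix₃ s)) (allConfigs r s))
                       (cong₂ _*_ (length-upTo (maxFix₃ s)) (length-allConfigs r))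

-- Lower bounds

double : ∀ {m} → Vec A m → Vec A (m * 2)
double []      = []
double (a ∷ u) = a ∷ a ∷ double u

double-injective : ∀ {m} {u v : Vec A m} → double u ≡ double v → u ≡ v
double-injective {u = []}    {[]}    _  = refl
double-injective {u = _ ∷ _} {_ ∷ _} eq =
  cong₂ _∷_ (∷-injectiveˡ eq) (double-injective (∷-injectiveʳ (∷-injectiveʳ eq)))

twin : ∀ m → Fin (m * 2) → Fin (m * 2)
twin (suc m) zero          = suc zero
twin (suc m) (suc zero)    = zero
twin (suc m) (suc (suc i)) = suc (suc (twin m i))

twin-≢ : ∀ m (i : Fin (m * 2)) → twin m i ≢ i
twin-≢ (suc m) (suc (suc i)) eq = twin-≢ m i (FP.suc-injective (FP.suc-injective eq))

lookup-double-twin : ∀ {m} (u : Vec A m) i → lookup (double u) (twin m i) ≡ lookup (double u) i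
lookup-double-twin (a ∷ u) zero          = refl
lookup-double-twin (a ∷ u) (suc zero)    = refl
lookup-double-twin (a ∷ u) (suc (suc i)) = lookup-double-twin u i

lowerBound-double : ∀ m s → LowerBound (m * 2) (suc s) (suc s ^ m)
lowerBound-double m s = subst (LowerBound (m * 2) (suc s)) length-doubles
  (Realise.lowerBound doubles compatible (Unique.map⁺ double-injective (allConfigs-unique m)))
  where
  doubles = map double (allConfigs m (suc s))
  compatible : ∀ {x y} → x ∈ doubles → y ∈ doubles → Compatible x y
  compatible x∈ y∈ with ∈-map⁻ double x∈ | ∈-map⁻ double y∈
  ... | u , _ , refl | v , _ , refl =
    twins⇒compatible (twin m) (twin-≢ m) {double u} {double v} (lookup-double-twin u) (lookup-double-twin v)
  length-doubles : length doubles ≡ suc s ^ m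
  length-doubles = trans (length-map double (allConfigs m (suc s))) (length-allConfigs m)

-- (0,0,0), (0,1,1), (1,1,2), (2,2,2), (2,3,3), … : each step raises two of the three coordinates.
chain : ℕ → Fin 3 → ℕ
chain 0 _                   = 0
chain 1 zero                = 0
chain 1 (suc _)             = 1
chain 2 zero                = 1
chain 2 (suc zero)          = 1
chain 2 (suc (suc zero))    = 2
chain (suc (suc (suc t))) i = 2 + chain t i

chain-≤-suc : ∀ t i → chain t i ≤ chain (suc t) i
chain-≤-suc 0 _                   = z≤n
chain-≤-suc 1 zero                = z≤n
chain-≤-suc 1 (suc zero)          = ≤-refl
chain-≤-suc 1 (suc (suc zero))    = s≤s z≤n
chain-≤-suc 2 zero                = s≤s z≤n
chain-≤-suc 2 (suc zero)          = s≤s z≤n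
chain-≤-suc 2 (suc (suc zero))    = ≤-refl
chain-≤-suc (suc (suc (suc t))) i = +-monoʳ-≤ 2 (chain-≤-suc t i)

chain-rises : ∀ t → ∃ λ j → ∃ λ k → j ≢ k × chain t j < chain (suc t) j × chain t k < chain (suc t) k
chain-rises 0 = suc zero , suc (suc zero) , (λ ()) , s≤s z≤n , s≤s z≤n
chain-rises 1 = zero , suc (suc zero) , (λ ()) , s≤s z≤n , s≤s (s≤s z≤n)
chain-rises 2 = zero , suc zero , (λ ()) , s≤s (s≤s z≤n) , s≤s (s≤s z≤n)
chain-rises (suc (suc (suc t))) =
  let j , k , j≢k , j< , k< = chain-rises t in j , k , j≢k , +-monoʳ-< 2 j< , +-monoʳ-< 2 k<

chain-bound : ∀ t i → 3 * chain t i ≤ 2 * t + 2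
chain-bound 0 _                   = z≤n
chain-bound 1 zero                = z≤n
chain-bound 1 (suc _)             = ≤ᵇ⇒≤ 3 4 _
chain-bound 2 zero                = ≤ᵇ⇒≤ 3 6 _
chain-bound 2 (suc zero)          = ≤ᵇ⇒≤ 3 6 _
chain-bound 2 (suc (suc zero))    = ≤-refl
chain-bound (suc (suc (suc t))) i = begin
  3 * (2 + chain t i)   ≡⟨ *-distribˡ-+ 3 2 (chain t i) ⟩
  6 + 3 * chain t i     ≤⟨ +-monoʳ-≤ 6 (chain-bound t i) ⟩
  6 + (2 * t + 2)       ≡⟨ shift t ⟩
  2 * (3 + t) + 2       ∎
  where
  open ≤-Reasoning
  shift : ∀ t → 6 + (2 * t + 2) ≡ 2 * (3 + t) + 2
  shift = solve-∀

chain-monotone : ∀ {t u} i → t ≤ u → chain t i ≤ chain u i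
chain-monotone i t≤u = go (≤⇒≤′ t≤u)
  where
  go : ∀ {t u} → t ≤′ u → chain t i ≤ chain u i
  go ≤′-refl                    = ≤-refl
  go {u = suc u} (≤′-step t≤u) = ≤-trans (go t≤u) (chain-≤-suc u i)

chain-risesTwice : ∀ {t u} → t < u → ∀ i → ∃ λ j → j ≢ i × chain t j < chain u j
chain-risesTwice {t} t<u i with chain-rises t
... | j , k , j≢k , j< , k< with j ≟ i
...   | yes refl = k , j≢k ∘ sym , <-≤-trans k< (chain-monotone k t<u)
...   | no  j≢i  = j , j≢i       , <-≤-trans j< (chain-monotone j t<u)

module _ (s : ℕ) where

  chain<suc : ∀ {t} → t ≤ 3 * s / 2 → ∀ i → chain t i < suc s
  chain<suc {t} t≤ i = *-cancelˡ-< 3 (chain t i) (suc s) (begin-strict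
    3 * chain t i        ≤⟨ chain-bound t i ⟩
    2 * t + 2            ≤⟨ +-monoˡ-≤ 2 (*-monoʳ-≤ 2 t≤) ⟩
    2 * (3 * s / 2) + 2  ≤⟨ +-monoˡ-≤ 2 (subst (_≤ 3 * s) (*-comm (3 * s / 2) 2) (m/n*n≤m (3 * s) 2)) ⟩
    3 * s + 2            <⟨ +-monoʳ-< (3 * s) ≤-refl ⟩
    3 * s + 3            ≡⟨ +-comm (3 * s) 3 ⟩
    3 + 3 * s            ≡⟨ sym (*-suc 3 s) ⟩
    3 * suc s            ∎)
    where open ≤-Reasoning

  chainPoint : Fin (suc (3 * s / 2)) → Fin 3 → Fin (suc s)
  chainPoint t i = fromℕ< (chain<suc (s≤s⁻¹ (FP.toℕ<n t)) i)

  chainConfig : Fin (suc (3 * s / 2)) → Config 3 (suc s)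
  chainConfig t = tabulate (chainPoint t)

  ⟦chainConfig⟧ : ∀ t i → ⟦ chainConfig t ⟧ i ≡ chain (toℕ t) i
  ⟦chainConfig⟧ t i = trans (cong toℕ (lookup∘tabulate (chainPoint t) i)) (FP.toℕ-fromℕ< _)

  chainConfig-compatible : ∀ t u → Compatible (chainConfig t) (chainConfig u)
  chainConfig-compatible t u with toℕ t ≤? toℕ u
  ... | yes t≤u = ≤⇒compatible {x = chainConfig t} {chainConfig u} λ j →
    subst₂ _≤_ (sym (⟦chainConfig⟧ t j)) (sym (⟦chainConfig⟧ u j)) (chain-monotone j t≤u)
  ... | no  t≰u = dropsTwice⇒compatible {x = chainConfig t} {chainConfig u} λ i →
    let j , j≢i , u<t = chain-risesTwice (≰⇒> t≰u) i in
    j , j≢i , subst₂ _<_ (sym (⟦chainConfig⟧ u j)) (sym (⟦chainConfig⟧ t j)) u<t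

  chainConfig-differs : ∀ {t u} → toℕ t < toℕ u → chainConfig t ≢ chainConfig u
  chainConfig-differs {t} {u} t<u eq = let j , _ , lt = chain-risesTwice t<u zero in
    <⇒≢ lt (trans (sym (⟦chainConfig⟧ t j)) (trans (cong (λ x → ⟦ x ⟧ j) eq) (⟦chainConfig⟧ u j)))

  chainConfig-injective : ∀ {t u} → chainConfig t ≡ chainConfig u → t ≡ u
  chainConfig-injective {t} {u} eq with <-cmp (toℕ t) (toℕ u)
  ... | tri< t<u _ _ = ⊥-elim (chainConfig-differs t<u eq)
  ... | tri≈ _ t≡u _ = FP.toℕ-injective t≡u
  ... | tri> _ _ u<t = ⊥-elim (chainConfig-differs u<t (sym eq))

lowerBound-chain : ∀ s → LowerBound 3 (suc s) (maxFix₃ (suc s))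
lowerBound-chain s = subst (LowerBound 3 (suc s)) length-chains
  (Realise.lowerBound chains compatible (Unique.map⁺ (chainConfig-injective s) (Unique.allFin⁺ _)))
  where
  chains = map (chainConfig s) (allFin (suc (3 * s / 2)))
  compatible : ∀ {x y} → x ∈ chains → y ∈ chains → Compatible x y
  compatible x∈ y∈ with ∈-map⁻ (chainConfig s) {xs = allFin _} x∈ | ∈-map⁻ (chainConfig s) {xs = allFin _} y∈
  ... | t , _ , refl | u , _ , refl = chainConfig-compatible s t u
  length-chains : length chains ≡ maxFix₃ (suc s)
  length-chains = trans (length-map (chainConfig s) (allFin _))
                        (trans (length-tabulate {n = suc (3 * s / 2)} id) (+-comm 1 (3 * s / 2)))

sum-mono-≤ : ∀ {n} {f g : Fin n → ℕ} → (∀ j → f j ≤ g j) → sum f ≤ sum g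
sum-mono-≤ {zero}  _   = z≤n
sum-mono-≤ {suc n} f≤g = +-mono-≤ (f≤g zero) (sum-mono-≤ (f≤g ∘ suc))

sum-mono-< : ∀ {n} {f g : Fin n → ℕ} i → (∀ j → f j ≤ g j) → f i < g i → sum f < sum g
sum-mono-< zero    f≤g fi<gi = +-mono-<-≤ fi<gi (sum-mono-≤ (f≤g ∘ suc))
sum-mono-< (suc i) f≤g fi<gi = +-mono-≤-< (f≤g zero) (sum-mono-< i (f≤g ∘ suc) fi<gi)

sum-≤-* : ∀ {n} {f : Fin n → ℕ} {b} → (∀ j → f j ≤ b) → sum f ≤ n * b
sum-≤-* {zero}  _    = z≤n
sum-≤-* {suc n} f≤b = +-mono-≤ (f≤b zero) (sum-≤-* (f≤b ∘ suc))

module _ {n s : ℕ} where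

  term : (ℕ → ℕ) → Config n s → Fin n → ℕ
  term w x j = w (toℕ j) * ⟦ x ⟧ j

  moment : (ℕ → ℕ) → Config n s → ℕ
  moment w x = sum (term w x)

  moments : Config n s → Triple
  moments x = moment (λ _ → 1) x , moment id x , moment (λ b → b * b) x

  -- φ a y x − φ a x y = Σⱼ ((j − a)² − 1) (yⱼ − xⱼ), written without subtraction.
  φ : ℕ → Config n s → Config n s → Fin n → ℕ
  φ a x y j = term (λ _ → 1) y j + term (λ b → b * b) x j + a * a * term (λ _ → 1) x j + 2 * a * term id y j

Φ : ℕ → Triple → Triple → ℕ
Φ a (m₀ , m₁ , _) (m₀′ , _ , m₂′) = m₀ + m₂′ + a * a * m₀′ + 2 * a * m₁

sum-φ : ∀ {n s} a (x y : Config n s) → sum (φ a x y) ≡ Φ a (moments y) (moments x)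
sum-φ a x y = begin
  sum (φ a x y)
    ≡⟨ ∑-distrib-+ (λ j → t₀ y j + t₂ x j + a * a * t₀ x j) (λ j → 2 * a * t₁ y j) ⟩
  sum (λ j → t₀ y j + t₂ x j + a * a * t₀ x j) + sum (λ j → 2 * a * t₁ y j)
    ≡⟨ cong₂ _+_ (∑-distrib-+ (λ j → t₀ y j + t₂ x j) (λ j → a * a * t₀ x j)) (sym (*-distribˡ-sum (2 * a) (t₁ y))) ⟩
  sum (λ j → t₀ y j + t₂ x j) + sum (λ j → a * a * t₀ x j) + 2 * a * moment id y
    ≡⟨ cong₂ (λ p q → p + q + 2 * a * moment id y) (∑-distrib-+ (t₀ y) (t₂ x)) (sym (*-distribˡ-sum (a * a) (t₀ x))) ⟩
  Φ a (moments y) (moments x) ∎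
  where
  open ≡-Reasoning
  t₀ = term (λ _ → 1)
  t₁ = term id
  t₂ = term (λ b → b * b)

squares-gap : ∀ {a b} → a ≢ b → 1 + 2 * a * b ≤ a * a + b * b
squares-gap {a} {b} a≢b with <-cmp a b
... | tri≈ _ a≡b _ = contradiction a≡b a≢b
... | tri< a<b _ _ with m≤n⇒∃[o]m+o≡n a<b
...   | e , refl = subst (1 + 2 * a * (suc a + e) ≤_) (sym (expand a e)) (m≤m+n _ _)
  where
  expand : ∀ a e → a * a + (suc a + e) * (suc a + e) ≡ 1 + 2 * a * (suc a + e) + e * (2 + e)
  expand = solve-∀
squares-gap {a} {b} a≢b | tri> _ _ b<a with m≤n⇒∃[o]m+o≡n b<a
...   | e , refl = subst (1 + 2 * (suc b + e) * b ≤_) (sym (expand b e)) (m≤m+n _ _)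
  where
  expand : ∀ b e → (suc b + e) * (suc b + e) + b * b ≡ 1 + 2 * (suc b + e) * b + e * (2 + e)
  expand = solve-∀

φ-off-centre : ∀ a b u v → a ≢ b → u ≤ v →
               1 * v + b * b * u + a * a * (1 * u) + 2 * a * (b * v) ≤ 1 * u + b * b * v + a * a * (1 * v) + 2 * a * (b * u)
φ-off-centre a b u v a≢b u≤v with m≤n⇒∃[o]m+o≡n u≤v
... | d , refl = begin
  1 * (u + d) + b * b * u + a * a * (1 * u) + 2 * a * (b * (u + d)) ≡⟨ lhs a b u d ⟩
  base + d * (1 + 2 * a * b)                                           ≤⟨ +-monoʳ-≤ base (*-monoʳ-≤ d (squares-gap a≢b)) ⟩
  base + d * (a * a + b * b)                                           ≡⟨ rhs a b u d ⟩
  1 * u + b * b * (u + d) + a * a * (1 * (u + d)) + 2 * a * (b * u)   ∎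
  where
  open ≤-Reasoning
  base = u + b * b * u + a * a * u + 2 * a * b * u
  lhs : ∀ a b u d → 1 * (u + d) + b * b * u + a * a * (1 * u) + 2 * a * (b * (u + d)) ≡
                    u + b * b * u + a * a * u + 2 * a * b * u + d * (1 + 2 * a * b)
  lhs = solve-∀
  rhs : ∀ a b u d → u + b * b * u + a * a * u + 2 * a * b * u + d * (a * a + b * b) ≡
                    1 * u + b * b * (u + d) + a * a * (1 * (u + d)) + 2 * a * (b * u)
  rhs = solve-∀

φ-centre : ∀ a u v → v < u →
           1 * v + a * a * u + a * a * (1 * u) + 2 * a * (a * v) < 1 * u + a * a * v + a * a * (1 * v) + 2 * a * (a * u)
φ-centre a u v v<u = subst₂ _<_ (rearrange a v u) (sym (rearrange′ a u v)) (+-monoˡ-< (2 * (a * a) * (u + v)) v<u)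
  where
  rearrange : ∀ a v u → v + 2 * (a * a) * (u + v) ≡ 1 * v + a * a * u + a * a * (1 * u) + 2 * a * (a * v)
  rearrange = solve-∀
  rearrange′ : ∀ a u v → 1 * u + a * a * v + a * a * (1 * v) + 2 * a * (a * u) ≡ u + 2 * (a * a) * (u + v)
  rearrange′ = solve-∀

module _ {n s : ℕ} {x y : Config n s} where

  equal-moments⇒compatible : moments x ≡ moments y → Compatible x y
  equal-moments⇒compatible moments≡ i x≤y with ⟦ x ⟧ i ≤? ⟦ y ⟧ i
  ... | yes xi≤yi = xi≤yi
  ... | no  xi≰yi = contradiction sums≡ (<⇒≢ (sum-mono-< i φ≤ (φ-centre a _ _ (≰⇒> xi≰yi))))
    where
    a = toℕ i
    sums≡ : sum (φ a x y) ≡ sum (φ a y x)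
    sums≡ = trans (sum-φ a x y) (trans (cong₂ (Φ a) (sym moments≡) moments≡) (sym (sum-φ a y x)))
    φ≤ : ∀ j → φ a x y j ≤ φ a y x j
    φ≤ j with j ≟ i
    ... | yes refl = <⇒≤ (φ-centre a _ _ (≰⇒> xi≰yi))
    ... | no  j≢i  = φ-off-centre a (toℕ j) _ _ (λ a≡j → j≢i (FP.toℕ-injective (sym a≡j))) (x≤y j j≢i)

momentRange : ℕ → ℕ → ℕ
momentRange n s = suc (n * (n * n * s))

module _ {n s : ℕ} where

  moment<momentRange : ∀ w → (∀ b → b < n → w b ≤ n * n) → (x : Config n s) → moment w x < momentRange n s
  moment<momentRange w w≤ x = s≤s (sum-≤-* λ j →
    *-mono-≤ (w≤ (toℕ j) (FP.toℕ<n j)) (<⇒≤ (FP.toℕ<n (lookup x j))))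

  moments∈cube : ∀ x → moments x ∈ cartesianProduct (upTo (momentRange n s))
                                      (cartesianProduct (upTo (momentRange n s)) (upTo (momentRange n s)))
  moments∈cube x = ∈-cartesianProduct⁺ (∈-upTo⁺ (moment<momentRange _ one≤ x))
    (∈-cartesianProduct⁺ (∈-upTo⁺ (moment<momentRange _ b≤ x)) (∈-upTo⁺ (moment<momentRange _ b*b≤ x)))
    where
    one≤ : ∀ b → b < n → 1 ≤ n * n
    one≤ b b<n = *-mono-≤ (≤-<-trans z≤n b<n) (≤-<-trans z≤n b<n)
    b≤ : ∀ b → b < n → b ≤ n * n
    b≤ b b<n = ≤-trans (<⇒≤ b<n) (m≤m*n n n {{>-nonZero (≤-<-trans z≤n b<n)}})
    b*b≤ : ∀ b → b < n → b * b ≤ n * n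
    b*b≤ b b<n = *-mono-≤ (<⇒≤ b<n) (<⇒≤ b<n)

lowerBound-moments : ∀ n s → Σ ℕ λ a → LowerBound n (suc s) a ×
                     suc s ^ n ≤ momentRange n (suc s) * (momentRange n (suc s) * momentRange n (suc s)) * a
lowerBound-moments n s =
  length cls , Realise.lowerBound cls compatible (Unique.filter⁺ _ (allConfigs-unique n)) ,
  subst₂ (λ total size → total ≤ size * length cls) (length-allConfigs n) length-cube class-large
  where
  R = momentRange n (suc s)
  cube = cartesianProduct (upTo R) (cartesianProduct (upTo R) (upTo R))
  _≟₃_ : DecidableEquality Triple
  _≟₃_ = ×.≡-dec ℕ._≟_ (×.≡-dec ℕ._≟_ ℕ._≟_)
  largest = pigeonhole moments _≟₃_ (0 , 0 , 0) cube (allConfigs n (suc s)) (λ {x} _ → moments∈cube {n} {suc s} x)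
  cls = fiber moments _≟₃_ (proj₁ largest) (allConfigs n (suc s))
  class-large : length (allConfigs n (suc s)) ≤ length cube * length cls
  class-large = proj₂ largest
  compatible : ∀ {x y} → x ∈ cls → y ∈ cls → Compatible x y
  compatible {x} {y} x∈ y∈ = equal-moments⇒compatible {x = x} {y}
    (trans (proj₂ (∈-filter⁻ _ {xs = allConfigs n (suc s)} x∈)) (sym (proj₂ (∈-filter⁻ _ {xs = allConfigs n (suc s)} y∈))))
  length-square : length (cartesianProduct (upTo R) (upTo R)) ≡ R * R
  length-square = trans (length-cartesianProductWith _,_ (upTo R) (upTo R)) (cong₂ _*_ (length-upTo R) (length-upTo R))
  length-cube : length cube ≡ R * (R * R)
  length-cube = trans (length-cartesianProductWith _,_ (upTo R) (cartesianProduct (upTo R) (upTo R)))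
                      (cong₂ _*_ (length-upTo R) length-square)

-- Growth estimates

^-distribʳ-* : ∀ m n o → (m * n) ^ o ≡ m ^ o * n ^ o
^-distribʳ-* m n zero    = refl
^-distribʳ-* m n (suc o) = trans (cong (m * n *_) (^-distribʳ-* m n o)) (interchange m n (m ^ o) (n ^ o))
  where
  interchange : ∀ a b c d → a * b * (c * d) ≡ a * c * (b * d)
  interchange = solve-∀

-- i.e. log_s m ≤ e + 1/(k+1)
log-upper-bound : ∀ {s m c} e k → m ≤ c * s ^ e → c ^ suc k ≤ s → m ^ suc k ≤ s ^ (e * suc k + 1)
log-upper-bound {s} {m} {c} e k m≤ c^≤s = begin
  m ^ suc k                    ≤⟨ ^-monoˡ-≤ (suc k) m≤ ⟩
  (c * s ^ e) ^ suc k          ≡⟨ ^-distribʳ-* c (s ^ e) (suc k) ⟩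
  c ^ suc k * (s ^ e) ^ suc k  ≤⟨ *-monoˡ-≤ _ c^≤s ⟩
  s * (s ^ e) ^ suc k          ≡⟨ cong (s *_) (^-*-assoc s e (suc k)) ⟩
  s ^ (1 + e * suc k)          ≡⟨ cong (s ^_) (+-comm 1 (e * suc k)) ⟩
  s ^ (e * suc k + 1)          ∎
  where open ≤-Reasoning

-- i.e. log_s m ≥ e + 1 − 1/(k+1)
log-lower-bound : ∀ {s m c} e k .{{_ : NonZero s}} → s ^ suc e ≤ c * m → c ^ suc k ≤ s →
                  s ^ (suc e * suc k ∸ 1) ≤ m ^ suc k
log-lower-bound {s} {m} {c} e k s^≤ c^≤s = *-cancelˡ-≤ s (begin
  s ^ (suc e * suc k)          ≡⟨ sym (^-*-assoc s (suc e) (suc k)) ⟩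
  (s ^ suc e) ^ suc k          ≤⟨ ^-monoˡ-≤ (suc k) s^≤ ⟩
  (c * m) ^ suc k              ≡⟨ ^-distribʳ-* c m (suc k) ⟩
  c ^ suc k * m ^ suc k        ≤⟨ *-monoˡ-≤ _ c^≤s ⟩
  s * m ^ suc k                ∎)
  where open ≤-Reasoning

maxFix₃-≥ : ∀ s → suc s ≤ maxFix₃ (suc s)
maxFix₃-≥ s = subst (_≤ maxFix₃ (suc s)) (+-comm s 1) (+-monoˡ-≤ 1 (begin
  s            ≡⟨ sym (m*n/n≡m s 2) ⟩
  s * 2 / 2    ≤⟨ /-monoˡ-≤ 2 (subst (_≤ 3 * s) (*-comm 2 s) (*-monoˡ-≤ s (≤ᵇ⇒≤ 2 3 _))) ⟩
  3 * s / 2    ∎))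
  where open ≤-Reasoning

maxFix₃-≤ : ∀ s → maxFix₃ (suc s) ≤ 2 * suc s
maxFix₃-≤ s = begin
  3 * s / 2 + 1               ≤⟨ +-monoˡ-≤ 1 (/-monoˡ-≤ 2 (subst (3 * s ≤_) (sym (expand s)) (m≤m+n (3 * s) (s + 2)))) ⟩
  (2 * s + 1) * 2 / 2 + 1     ≡⟨ cong (_+ 1) (m*n/n≡m (2 * s + 1) 2) ⟩
  2 * s + 1 + 1               ≡⟨ regroup s ⟩
  2 * suc s                   ∎
  where
  open ≤-Reasoning
  expand : ∀ s → (2 * s + 1) * 2 ≡ 3 * s + (s + 2)
  expand = solve-∀
  regroup : ∀ s → 2 * s + 1 + 1 ≡ 2 * suc s
  regroup = solve-∀

-- The networks K₂⁺, K₃⁺, K₄⁺ and Kₙ⁺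

maxFix-K₂ : ∀ s → IsMaxFix 2 (suc s) (suc s)
maxFix-K₂ s = isMaxFix (subst (LowerBound 2 (suc s)) (*-identityʳ (suc s)) (lowerBound-double 1 s))
                       (subst (UpperBound 2 (suc s)) (*-identityʳ (suc s)) (upperBound-tail 1 (suc s)))

maxFix-K₃ : ∀ s → IsMaxFix 3 (suc s) (maxFix₃ (suc s))
maxFix-K₃ s = isMaxFix (lowerBound-chain s)
                       (subst (UpperBound 3 (suc s)) (*-identityʳ _) (upperBound-halfSum 0 (suc s)))

maxFix-K₃-≥ : ∀ s → 2 ≤ s → ∀ m → IsMaxFix 3 s m → s ≤ m
maxFix-K₃-≥ (suc s) _ m max = subst (suc s ≤_) (IsMaxFix-unique (maxFix-K₃ s) max) (maxFix₃-≥ s)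

maxFix-K₄-≥ : ∀ s m → IsMaxFix 4 (suc s) m → suc s ^ 2 ≤ m
maxFix-K₄-≥ s m max = IsMaxFix⇒≥ max (lowerBound-double 2 s)

maxFix-≤ : ∀ r s m → IsMaxFix (3 + r) (suc s) m → m ≤ 2 * suc s ^ suc r
maxFix-≤ r s m max = begin
  m                          ≤⟨ IsMaxFix⇒≤ max (upperBound-halfSum r (suc s)) ⟩
  maxFix₃ (suc s) * suc s ^ r ≤⟨ *-monoˡ-≤ _ (maxFix₃-≤ s) ⟩
  2 * suc s * suc s ^ r       ≡⟨ *-assoc 2 (suc s) _ ⟩
  2 * suc s ^ suc r           ∎
  where open ≤-Reasoning

momentConstant : ℕ → ℕ
momentConstant n = let d = 2 * (n * (n * n)) in d * (d * d)

momentRange-≤ : ∀ {n s} → 1 ≤ n → 1 ≤ s → momentRange n s ≤ 2 * (n * (n * n)) * s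
momentRange-≤ {n} {s} 1≤n 1≤s = begin
  suc (n * (n * n * s))                 ≤⟨ +-monoˡ-≤ _ (*-mono-≤ 1≤n (*-mono-≤ (*-mono-≤ 1≤n 1≤n) 1≤s)) ⟩
  n * (n * n * s) + n * (n * n * s)     ≡⟨ regroup n s ⟩
  2 * (n * (n * n)) * s                 ∎
  where
  open ≤-Reasoning
  regroup : ∀ n s → n * (n * n * s) + n * (n * n * s) ≡ 2 * (n * (n * n)) * s
  regroup = solve-∀

maxFix-≥ : ∀ {n} s m → 1 ≤ n → IsMaxFix n (suc s) m → suc s ^ n ≤ suc s * (suc s * (suc s * (momentConstant n * m)))
maxFix-≥ {n} s m 1≤n max = let a , lower , sⁿ≤ = lowerBound-moments n s in begin
  suc s ^ n                                  ≤⟨ sⁿ≤ ⟩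
  R * (R * R) * a                            ≤⟨ *-mono-≤ (*-mono-≤ R≤ (*-mono-≤ R≤ R≤)) (IsMaxFix⇒≥ max lower) ⟩
  d * suc s * (d * suc s * (d * suc s)) * m  ≡⟨ regroup d (suc s) m ⟩
  suc s * (suc s * (suc s * (d * (d * d) * m))) ∎
  where
  open ≤-Reasoning
  d = 2 * (n * (n * n))
  R = momentRange n (suc s)
  R≤ : R ≤ d * suc s
  R≤ = momentRange-≤ 1≤n (s≤s z≤n)
  regroup : ∀ d t m → d * t * (d * t * (d * t)) * m ≡ t * (t * (t * (d * (d * d) * m)))
  regroup = solve-∀

eventually-log≤ : ∀ r k → Σ ℕ λ S → ∀ s → S ≤ s → 2 ≤ s → ∀ m → IsMaxFix (3 + r) s m →
                  m ^ suc k ≤ s ^ (suc r * suc k + 1)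
eventually-log≤ r k = 2 ^ suc k , λ { (suc s) 2ᵏ⁺¹≤s _ m max → log-upper-bound (suc r) k (maxFix-≤ r s m max) 2ᵏ⁺¹≤s }

frequently-log≥ : ∀ n → 4 ≤ n → ∀ k S → Σ ℕ λ s → S ≤ s × 2 ≤ s ×
                  (∀ m → IsMaxFix n s m → s ^ ((n ∸ 3) * suc k ∸ 1) ≤ m ^ suc k)
frequently-log≥ _ (s≤s (s≤s (s≤s (s≤s {n = r} _)))) k S =
  s , ≤-trans (m≤m+n S _) (m≤n+m _ 2) , m≤m+n 2 _ ,
  λ m max → log-lower-bound {m = m} {c} r k (cancel³ {s ^ suc r} {c * m} (maxFix-≥ {4 + r} _ m (s≤s z≤n) max))
                            (≤-trans (m≤n+m _ S) (m≤n+m _ 2))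
  where
  c = momentConstant (4 + r)
  s = 2 + (S + c ^ suc k)
  cancel³ : ∀ {x y} → s * (s * (s * x)) ≤ s * (s * (s * y)) → x ≤ y
  cancel³ {x} {y} h = *-cancelˡ-≤ {x} {y} s (*-cancelˡ-≤ {s * x} {s * y} s (*-cancelˡ-≤ {s * (s * x)} {s * (s * y)} s h))

log-K₃-tends-to-1 : ∀ k → Σ ℕ λ S → ∀ s → S ≤ s → 2 ≤ s → ∀ m → IsMaxFix 3 s m →
                    (s ^ k ≤ m ^ suc k) × (m ^ suc k ≤ s ^ (k + 2))
log-K₃-tends-to-1 k = let S , upper = eventually-log≤ 0 k in S , λ s S≤s 2≤s m max →
  ≤-trans (m≤n*m (s ^ k) s {{>-nonZero (≤-trans (s≤s z≤n) 2≤s)}}) (^-monoˡ-≤ (suc k) (maxFix-K₃-≥ s 2≤s m max)) ,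
  subst (λ e → m ^ suc k ≤ s ^ e) (exponent k) (upper s S≤s 2≤s m max)
  where
  exponent : ∀ k → 1 * suc k + 1 ≡ k + 2
  exponent = solve-∀

log-K₃-inf : ∀ k → Σ ℕ λ s → 2 ≤ s × (∀ m → IsMaxFix 3 s m → m ^ suc k ≤ s ^ (k + 2))
log-K₃-inf k = let S , bounds = log-K₃-tends-to-1 k in
  2 + S , m≤m+n 2 S , λ m max → proj₂ (bounds (2 + S) (m≤n+m S 2) (m≤m+n 2 S) m max)

log-K₄-tends-to-2 : ∀ k → Σ ℕ λ S → ∀ s → S ≤ s → 2 ≤ s → ∀ m → IsMaxFix 4 s m →
                    (s ^ (2 * suc k ∸ 1) ≤ m ^ suc k) × (m ^ suc k ≤ s ^ (2 * suc k + 1))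
log-K₄-tends-to-2 k = let S , upper = eventually-log≤ 1 k in
  S , λ s S≤s 2≤s m max → lower s 2≤s m max , upper s S≤s 2≤s m max
  where
  lower : ∀ s → 2 ≤ s → ∀ m → IsMaxFix 4 s m → s ^ (2 * suc k ∸ 1) ≤ m ^ suc k
  lower (suc s) _ m max = ≤-trans (^-monoʳ-≤ (suc s) (m∸n≤m (2 * suc k) 1))
    (subst (_≤ m ^ suc k) (^-*-assoc (suc s) 2 (suc k)) (^-monoˡ-≤ (suc k) (maxFix-K₄-≥ s m max)))

proposition6 :
    -- g(K_2^+, s) = 1, i.e. the maximum number of fixed points is s
    (∀ s → 2 ≤ s → IsMaxFix 2 s s)
    -- g(K_3^+, s) = log_s (⌊3(s-1)/2⌋ + 1)
    × (∀ s → 2 ≤ s → IsMaxFix 3 s ((3 * (s ∸ 1)) / 2 + 1))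
    -- lim_{s→∞} g(K_3^+, s) = 1 : for every ε = 1/(k+1), eventually
    -- 1 - ε ≤ g ≤ 1 + ε, i.e. s^k ≤ m^(k+1) ≤ s^(k+2)
    × (∀ k → Σ ℕ λ S → ∀ s → S ≤ s → 2 ≤ s → ∀ m → IsMaxFix 3 s m →
         (s ^ k ≤ m ^ suc k) × (m ^ suc k ≤ s ^ (k + 2)))
    -- inf_{s≥2} g(K_3^+, s) = 1 : g ≥ 1 for all s ≥ 2, and for every
    -- ε = 1/(k+1) some s ≥ 2 has g ≤ 1 + ε
    × (∀ s → 2 ≤ s → ∀ m → IsMaxFix 3 s m → s ≤ m)
    × (∀ k → Σ ℕ λ s → 2 ≤ s × (∀ m → IsMaxFix 3 s m → m ^ suc k ≤ s ^ (k + 2)))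
    -- lim_{s→∞} g(K_4^+, s) = 2
    × (∀ k → Σ ℕ λ S → ∀ s → S ≤ s → 2 ≤ s → ∀ m → IsMaxFix 4 s m →
         (s ^ (2 * suc k ∸ 1) ≤ m ^ suc k) × (m ^ suc k ≤ s ^ (2 * suc k + 1)))
    -- for n ≥ 4: limsup_{s→∞} g(K_n^+, s) ≥ n - 3, i.e. for every ε = 1/(k+1)
    -- and every S there is s ≥ S with g ≥ n - 3 - ε
    × (∀ n → 4 ≤ n → ∀ k S → Σ ℕ λ s → S ≤ s × 2 ≤ s ×
         (∀ m → IsMaxFix n s m → s ^ ((n ∸ 3) * suc k ∸ 1) ≤ m ^ suc k))
    -- for n ≥ 4: limsup_{s→∞} g(K_n^+, s) ≤ n - 2, i.e. for every ε = 1/(k+1)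
    -- eventually g ≤ n - 2 + ε
    × (∀ n → 4 ≤ n → ∀ k → Σ ℕ λ S → ∀ s → S ≤ s → 2 ≤ s → ∀ m → IsMaxFix n s m →
         m ^ suc k ≤ s ^ ((n ∸ 2) * suc k + 1))
proposition6 =
    (λ { (suc s) _ → maxFix-K₂ s })
  , (λ { (suc s) _ → maxFix-K₃ s })
  , log-K₃-tends-to-1
  , maxFix-K₃-≥
  , log-K₃-inf
  , log-K₄-tends-to-2
  , frequently-log≥
  , λ { _ (s≤s (s≤s (s≤s (s≤s {n = r} _)))) → eventually-log≤ (suc r) }
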